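{- Let $G=(V,E)$ be a bispanning graph, $(S,T)$ a pair of disjoint spanning trees with $S\cup T=E$, $m=|E|/2$, and let $\langle(e_1,f_1),\ldots,(e_m,f_m)\rangle$ be a unique exchange cyclic base ordering of $G$ and $(S,T)$. Then $\langle(f_m,e_m),\ldots,(f_1,e_1)\rangle$ is also a unique exchange cyclic base ordering of $G$ and $(S,T)$.
   Context: Graphs are finite, undirected, possibly with parallel edges, no loops; bispanning means the edge set is the disjoint union of two spanning trees. For a spanning tree $T$ and $e\notin T$, $C_G(T,e)$ is the unique cycle in $T+e$; for a spanning tree $S$ and $e\in S$, $D_G(S,e)$ is the set of edges joining the two components of $S-e$. For an ordered pair $(X,Y)$ of disjoint spanning trees covering $E$, a pair $(e,f)$ is a unique $X$ exchange if $e\in X$, $f\in Y$ and $D_G(X,e)\cap C_G(Y,e)=\{e,f\}$, and a unique $Y$ exchange if $e\in Y$, $f\in X$ and $D_G(Y,e)\cap C_G(X,e)=\{e,f\}$. A unique exchange cyclic base ordering (UECBO) of $G$ and $(S,T)$ is a sequence $\langle(e_1,f_1),\ldots,(e_m,f_m)\rangle$ for which there are enumerations $S=\{s_1,\ldots,s_m\}$, $T=\{t_1,\ldots,t_m\}$ such that for each $i$, $(e_i,f_i)\in\{(s_i,t_i),(t_i,s_i)\}$ and $(e_i,f_i)$ is a unique $X_i$ or $Y_i$ exchange for $(X_i,Y_i)=(\{s_i,\ldots,s_m,t_1,\ldots,t_{i-1}\},\{t_i,\ldots,t_m,s_1,\ldots,s_{i-1}\})$. -}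

module Defs where

open import Data.Nat using (ℕ)
open import Data.Fin using (Fin; _<_; _≤_; opposite)
open import Data.Product using (Σ; ∃; ∃-syntax; _×_; _,_; proj₁; proj₂)
open import Data.Sum using (_⊎_)
open import Data.List using (List; []; _∷_)
open import Data.List.Membership.Propositional using (_∈_)
open import Data.List.Relation.Unary.Unique.Propositional using (Unique)
open import Relation.Binary.PropositionalEquality using (_≡_; _≢_)
open import Relation.Nullary using (¬_)
open import Function.Definitions using (Injective)

-- A finite multigraph without loops: vertices Fin n, edges Fin k,
-- each edge has an (unordered) pair of distinct endpoints.
record Graph (n k : ℕ) : Set where
  field
    ends     : Fin k → Fin n × Fin n
    loopless : ∀ g → proj₁ (ends g) ≢ proj₂ (ends g)

open Graph public

EdgeSet : ℕ → Set₁
EdgeSet k = Fin k → Set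

module _ {n k : ℕ} (G : Graph n k) where

  Joins : Fin k → Fin n → Fin n → Set
  Joins g a b = (ends G g ≡ (a , b)) ⊎ (ends G g ≡ (b , a))

  _∖_ : EdgeSet k → Fin k → EdgeSet k
  (X ∖ e) g = X g × g ≢ e

  data Walk (X : EdgeSet k) : Fin n → Fin n → Set where
    nil  : ∀ u → Walk X u u
    cons : ∀ {a b v} (g : Fin k) → X g → Joins g a b → Walk X b v → Walk X a v

  walkVerts : ∀ {X u v} → Walk X u v → List (Fin n)
  walkVerts (nil u) = u ∷ []
  walkVerts (cons {a = a} g _ _ w) = a ∷ walkVerts w

  walkEdges : ∀ {X u v} → Walk X u v → List (Fin k)
  walkEdges (nil u) = []
  walkEdges (cons g _ _ w) = g ∷ walkEdges w

  Path : EdgeSet k → Fin n → Fin n → Set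
  Path X u v = Σ (Walk X u v) λ w → Unique (walkVerts w)

  Connected : EdgeSet k → Set
  Connected X = ∀ u v → Walk X u v

  Acyclic : EdgeSet k → Set
  Acyclic X = ∀ g → X g → ¬ Path (X ∖ g) (proj₁ (ends G g)) (proj₂ (ends G g))

  SpanningTree : EdgeSet k → Set
  SpanningTree X = Connected X × Acyclic X

  Partition : EdgeSet k → EdgeSet k → Set
  Partition X Y = (∀ g → X g → Y g → ⊥') × (∀ g → X g ⊎ Y g)
    where open import Data.Empty renaming (⊥ to ⊥')

  Bispanning : Set₁
  Bispanning = ∃[ S ] ∃[ T ] (SpanningTree S × SpanningTree T × Partition S T)

  -- C_G(T,e): the unique cycle in T + e (e ∉ T): e together with the edges of
  -- the path in T between the endpoints of e.
  Cyc : EdgeSet k → Fin k → EdgeSet k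
  Cyc T e g = (g ≡ e) ⊎
    (Σ (Path T (proj₁ (ends G e)) (proj₂ (ends G e))) λ p → g ∈ walkEdges (proj₁ p))

  -- D_G(S,e): edges joining the two components of S - e (e ∈ S)
  Cut : EdgeSet k → Fin k → EdgeSet k
  Cut S e g = ¬ Walk (S ∖ e) (proj₁ (ends G g)) (proj₂ (ends G g))

  UniqueXExchange : EdgeSet k → EdgeSet k → Fin k × Fin k → Set
  UniqueXExchange X Y (e , f) =
    X e × Y f ×
    (∀ g → ((Cut X e g × Cyc Y e g) → (g ≡ e ⊎ g ≡ f)) ×
           ((g ≡ e ⊎ g ≡ f) → (Cut X e g × Cyc Y e g)))

  UniqueYExchange : EdgeSet k → EdgeSet k → Fin k × Fin k → Set
  UniqueYExchange X Y (e , f) =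
    Y e × X f ×
    (∀ g → ((Cut Y e g × Cyc X e g) → (g ≡ e ⊎ g ≡ f)) ×
           ((g ≡ e ⊎ g ≡ f) → (Cut Y e g × Cyc X e g)))

  Enumerates : {m : ℕ} → (Fin m → Fin k) → EdgeSet k → Set
  Enumerates s S = Injective _≡_ _≡_ s × (∀ g → (S g → ∃[ i ] s i ≡ g) × (∃[ i ] s i ≡ g → S g))

  -- indices are 0-based: position i corresponds to index i+1 of the paper
  Xᵢ : {m : ℕ} → (Fin m → Fin k) → (Fin m → Fin k) → Fin m → EdgeSet k
  Xᵢ s t i g = (∃[ j ] (i ≤ j × s j ≡ g)) ⊎ (∃[ j ] (j < i × t j ≡ g))

  Yᵢ : {m : ℕ} → (Fin m → Fin k) → (Fin m → Fin k) → Fin m → EdgeSet k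
  Yᵢ s t i g = (∃[ j ] (i ≤ j × t j ≡ g)) ⊎ (∃[ j ] (j < i × s j ≡ g))

  UECBO : EdgeSet k → EdgeSet k → (m : ℕ) → (Fin m → Fin k × Fin k) → Set
  UECBO S T m σ = ∃[ s ] ∃[ t ] (Enumerates s S × Enumerates t T ×
    (∀ i → ((σ i ≡ (s i , t i)) ⊎ (σ i ≡ (t i , s i))) ×
           (UniqueXExchange (Xᵢ s t i) (Yᵢ s t i) (σ i) ⊎
            UniqueYExchange (Xᵢ s t i) (Yᵢ s t i) (σ i))))

swap : ∀ {k} → Fin k × Fin k → Fin k × Fin k
swap (e , f) = (f , e)

reverseSeq : ∀ {m k} → (Fin m → Fin k × Fin k) → Fin m → Fin k × Fin k
reverseSeq σ i = swap (σ (opposite i))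

module Submission where

-- Let Xᵢ, Yᵢ be the trees before the i-th exchange of the given ordering, so that
-- Xᵢ₊₁ = Xᵢ − sᵢ + tᵢ and Yᵢ₊₁ = Yᵢ − tᵢ + sᵢ.  The trees before the i-th exchange
-- of the reversed ordering are Yⱼ₊₁ and Xⱼ₊₁ for j = m + 1 − i, so it suffices
-- that whenever (e, f) is a unique exchange for (A, B), the pair (f, e) is one for
-- (A′, B′) = (A − e + f, B − f + e).  The cuts agree because A′ − f = A − e, and
-- the fundamental cycle of f in B′ is that of e in B: both consist of e, f and two
-- paths of the forest B − f.  This needs B acyclic, which holds for all Xᵢ, Yᵢ by
-- induction along the original ordering: trading e ∈ A for an edge f of the cut
-- D(A, e), or f ∈ B for e when f lies on the cycle C(B, e), creates no cycle.

open import Defs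
open import Data.Nat as ℕ using (ℕ; zero; suc; _+_; s≤s; s≤s⁻¹)
open import Data.Nat.Properties
  using ( <⇒≤; ≤-refl; <-irrefl; ≤∧≢⇒<; m<n⇒m<1+n; m<1+n⇒m<n∨m≡n
        ; ∸-monoʳ-≤; ∸-monoʳ-<)
open import Data.Fin as Fin using (Fin; toℕ; opposite; fromℕ<; _≟_)
open import Data.Fin.Properties
  using (toℕ-injective; toℕ<n; toℕ-fromℕ<; opposite-prop; opposite-involutive)
open import Data.Product as Product using (∃-syntax; _×_; _,_; proj₁; proj₂)
open import Data.Sum as Sum using (_⊎_; inj₁; inj₂)
open import Data.Empty using (⊥; ⊥-elim)
open import Data.List.Membership.Propositional using (_∈_; _∉_)
open import Data.List.Relation.Unary.Any using (here; there; any?)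
open import Data.List.Relation.Unary.All using ([]; lookup)
open import Data.List.Relation.Unary.All.Properties using (¬Any⇒All¬)
open import Data.List.Relation.Unary.AllPairs using ([]; _∷_)
open import Data.List.Relation.Unary.Unique.Propositional using (Unique)
open import Function using (_∘_)
open import Function.Definitions using (Injective)
open import Relation.Binary.PropositionalEquality
  using (_≡_; _≢_; refl; sym; trans; cong; subst)
open import Relation.Nullary using (¬_; yes; no)
open import Relation.Nullary.Decidable using (decidable-stable)
open import Relation.Unary using (_⊆_; _≐_; _∪_; ｛_｝)
open import Relation.Unary.Properties using (≐-trans)

opposite-injective : ∀ {m} → Injective _≡_ _≡_ (opposite {m})
opposite-injective {x = i} {j} eq =
  trans (sym (opposite-involutive i)) (trans (cong opposite eq) (opposite-involutive j))

opposite-≤ : ∀ {m} {i j : Fin m} → i Fin.≤ j → opposite j Fin.≤ opposite i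
opposite-≤ {m} {i} {j} i≤j rewrite opposite-prop i | opposite-prop j = ∸-monoʳ-≤ m (s≤s i≤j)

opposite-< : ∀ {m} {i j : Fin m} → i Fin.< j → opposite j Fin.< opposite i
opposite-< {i = i} {j} i<j rewrite opposite-prop i | opposite-prop j =
  ∸-monoʳ-< (s≤s i<j) (toℕ<n j)

-- Xᵢ G s t i is Window s t (toℕ i) and Yᵢ G s t i is Window t s (toℕ i); indexing
-- by ℕ admits the position m reached after the last exchange.
Window : ∀ {k m} → (Fin m → Fin k) → (Fin m → Fin k) → ℕ → Fin k → Set
Window s t i g = (∃[ j ] (i ℕ.≤ toℕ j × s j ≡ g)) ⊎ (∃[ j ] (toℕ j ℕ.< i × t j ≡ g))

window-notin : ∀ {k m} {s t : Fin m → Fin k} → Injective _≡_ _≡_ t → (∀ i j → s i ≢ t j) →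
  ∀ i → ¬ Window s t (toℕ i) (t i)
window-notin injective disjoint i (inj₁ (j , _ , sj≡ti)) = disjoint j i sj≡ti
window-notin injective disjoint i (inj₂ (j , j<i , tj≡ti)) =
  <-irrefl (cong toℕ (injective tj≡ti)) j<i

window-opposite : ∀ {k m} (s t : Fin m → Fin k) (i : Fin m) →
  Window (s ∘ opposite) (t ∘ opposite) (toℕ i) ≐ Window t s (suc (toℕ (opposite i)))
window-opposite s t i = into , onto
  where
    into : Window (s ∘ opposite) (t ∘ opposite) (toℕ i)
         ⊆ Window t s (suc (toℕ (opposite i)))
    into (inj₁ (j , i≤j , refl)) = inj₂ (opposite j , s≤s (opposite-≤ i≤j) , refl)
    into (inj₂ (j , j<i , refl)) = inj₁ (opposite j , opposite-< j<i , refl)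

    onto : Window t s (suc (toℕ (opposite i)))
         ⊆ Window (s ∘ opposite) (t ∘ opposite) (toℕ i)
    onto (inj₁ (j , i′<j , refl)) =
      inj₂ ( opposite j
           , subst (opposite j Fin.<_) (opposite-involutive i) (opposite-< i′<j)
           , cong t (opposite-involutive j))
    onto (inj₂ (j , j≤i′ , refl)) =
      inj₁ ( opposite j
           , subst (Fin._≤ opposite j) (opposite-involutive i) (opposite-≤ (s≤s⁻¹ j≤i′))
           , cong s (opposite-involutive j))

module _ {n k : ℕ} (G : Graph n k) where

  end₁ end₂ : Fin k → Fin n
  end₁ g = proj₁ (ends G g)
  end₂ g = proj₂ (ends G g)

  infixl 6 _−_
  _−_ : EdgeSet k → Fin k → EdgeSet k
  _−_ = _∖_ G

  Joins-sym : ∀ {g a b} → Joins G g a b → Joins G g b a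
  Joins-sym (inj₁ eq) = inj₂ eq
  Joins-sym (inj₂ eq) = inj₁ eq

  edgeWalk : ∀ {X g} → X g → Walk G X (end₁ g) (end₂ g)
  edgeWalk {g = g} x = cons g x (inj₁ refl) (nil _)

  mapWalk : ∀ {X Y u v} → X ⊆ Y → Walk G X u v → Walk G Y u v
  mapWalk X⊆Y (nil u) = nil u
  mapWalk X⊆Y (cons g x j w) = cons g (X⊆Y x) j (mapWalk X⊆Y w)

  infixr 5 _++ʷ_
  _++ʷ_ : ∀ {X u v w} → Walk G X u v → Walk G X v w → Walk G X u w
  nil _ ++ʷ w′ = w′
  cons g x j w ++ʷ w′ = cons g x j (w ++ʷ w′)

  reverseWalk : ∀ {X u v} → Walk G X u v → Walk G X v u
  reverseWalk (nil u) = nil u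
  reverseWalk (cons g x j w) = reverseWalk w ++ʷ cons g x (Joins-sym j) (nil _)

  orient : ∀ {X g a b} → Joins G g a b → Walk G X a b → Walk G X (end₁ g) (end₂ g)
  orient (inj₁ refl) w = w
  orient (inj₂ refl) w = reverseWalk w

  avoidingWalk : ∀ {X u v f} (w : Walk G X u v) → f ∉ walkEdges G w → Walk G (X − f) u v
  avoidingWalk (nil u) _ = nil u
  avoidingWalk (cons g x j w) f∉ =
    cons g (x , λ { refl → f∉ (here refl) }) j (avoidingWalk w (f∉ ∘ there))

  separating-edge∈ : ∀ {X u v f} (w : Walk G X u v) → ¬ Walk G (X − f) u v → f ∈ walkEdges G w
  separating-edge∈ {f = f} w cut =
    decidable-stable (any? (f ≟_) (walkEdges G w)) (cut ∘ avoidingWalk w)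

  start∈walkVerts : ∀ {X u v} (w : Walk G X u v) → u ∈ walkVerts G w
  start∈walkVerts (nil _) = here refl
  start∈walkVerts (cons _ _ _ _) = here refl

  ends∈walkVerts : ∀ {X u v g} (w : Walk G X u v) → g ∈ walkEdges G w →
    end₁ g ∈ walkVerts G w × end₂ g ∈ walkVerts G w
  ends∈walkVerts (cons g x (inj₁ refl) w) (here refl) = here refl , there (start∈walkVerts w)
  ends∈walkVerts (cons g x (inj₂ refl) w) (here refl) = there (start∈walkVerts w) , here refl
  ends∈walkVerts (cons g x j w) (there g∈) = Product.map there there (ends∈walkVerts w g∈)

  joins∈walkVerts : ∀ {X u v g a b} (w : Walk G X u v) → g ∈ walkEdges G w → Joins G g a b →
    a ∈ walkVerts G w
  joins∈walkVerts w g∈ (inj₁ refl) = proj₁ (ends∈walkVerts w g∈)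
  joins∈walkVerts w g∈ (inj₂ refl) = proj₂ (ends∈walkVerts w g∈)

  suffixPath : ∀ {X u v a} (w : Walk G X u v) → Unique (walkVerts G w) → a ∈ walkVerts G w →
    Path G X a v
  suffixPath w@(nil _) uniq (here refl) = w , uniq
  suffixPath w@(cons _ _ _ _) uniq (here refl) = w , uniq
  suffixPath (cons _ _ _ w) (_ ∷ uniq) (there a∈) = suffixPath w uniq a∈

  walk⇒path : ∀ {X u v} → Walk G X u v → Path G X u v
  walk⇒path (nil u) = nil u , [] ∷ []
  walk⇒path (cons {a = a} g x j w) with walk⇒path w
  ... | p , uniq with any? (a ≟_) (walkVerts G p)
  ...   | yes a∈ = suffixPath p uniq a∈
  ...   | no a∉ = cons g x j p , ¬Any⇒All¬ _ a∉ ∷ uniq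

  avoidOrReach : ∀ {X u v} f → Walk G X u v →
    Walk G (X − f) u v ⊎ (Walk G (X − f) (end₁ f) v ⊎ Walk G (X − f) (end₂ f) v)
  avoidOrReach f (nil u) = inj₁ (nil u)
  avoidOrReach f (cons g x j w) with avoidOrReach f w | g ≟ f
  ... | inj₂ reach | _ = inj₂ reach
  ... | inj₁ w′ | no g≢f = inj₁ (cons g (x , g≢f) j w′)
  ... | inj₁ w′ | yes refl = inj₂ (fromEnd j w′)
    where
      fromEnd : ∀ {Z a b v} → Joins G f a b → Walk G Z b v →
        Walk G Z (end₁ f) v ⊎ Walk G Z (end₂ f) v
      fromEnd (inj₁ refl) w = inj₂ w
      fromEnd (inj₂ refl) w = inj₁ w

  reroute : ∀ {Z Z′ e} f → Z − f ⊆ Z′ → Z′ e → Walk G Z (end₁ e) (end₂ e) →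
    Walk G (Z − f) (end₁ e) (end₂ e) ⊎ Walk G Z′ (end₁ f) (end₂ f)
  reroute f sub z′e w with avoidOrReach f w | avoidOrReach f (reverseWalk w)
  ... | inj₁ w′ | _ = inj₁ w′
  ... | _ | inj₁ w′ = inj₁ (reverseWalk w′)
  ... | inj₂ (inj₁ a) | inj₂ (inj₁ b) = inj₁ (reverseWalk b ++ʷ a)
  ... | inj₂ (inj₂ a) | inj₂ (inj₂ b) = inj₁ (reverseWalk b ++ʷ a)
  ... | inj₂ (inj₁ a) | inj₂ (inj₂ b) =
    inj₂ (mapWalk sub a ++ʷ reverseWalk (edgeWalk z′e) ++ʷ reverseWalk (mapWalk sub b))
  ... | inj₂ (inj₂ a) | inj₂ (inj₁ b) =
    inj₂ (mapWalk sub b ++ʷ edgeWalk z′e ++ʷ reverseWalk (mapWalk sub a))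

  Forest : EdgeSet k → Set
  Forest X = ∀ {g} → X g → ¬ Walk G (X − g) (end₁ g) (end₂ g)

  acyclic⇒forest : ∀ {X} → Acyclic G X → Forest X
  acyclic⇒forest acyclic {g} x = acyclic g x ∘ walk⇒path

  forest-⊆ : ∀ {X Y} → Forest X → Y ⊆ X → Forest Y
  forest-⊆ forest Y⊆X y = forest (Y⊆X y) ∘ mapWalk (Product.map₁ Y⊆X)

  pathEdge-separates : ∀ {X u v f} → Forest X → (w : Walk G X u v) → Unique (walkVerts G w) →
    f ∈ walkEdges G w → ¬ Walk G (X − f) u v
  pathEdge-separates forest (cons g x j w) (u∉ ∷ uniq) f∈ w′ with any? (g ≟_) (walkEdges G w)
  ... | yes g∈ = lookup u∉ (joins∈walkVerts w g∈ j) refl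
  ... | no g∉ with f∈
  ...   | here refl = forest x (orient j (w′ ++ʷ reverseWalk (avoidingWalk w g∉)))
  ...   | there f∈w =
    pathEdge-separates forest w uniq f∈w (cons g (x , λ { refl → g∉ f∈w }) (Joins-sym j) w′)

  drop-added : ∀ {X Y e f} → Y ⊆ (X − e) ∪ ｛ f ｝ → Y − f ⊆ X − e
  drop-added Y⊆ (y , g≢f) with Y⊆ y
  ... | inj₁ x = x
  ... | inj₂ refl = ⊥-elim (g≢f refl)

  exchange-forest : ∀ {X Y e f} → Forest X → ¬ Walk G (X − e) (end₁ f) (end₂ f) →
    Y ⊆ (X − e) ∪ ｛ f ｝ → Forest Y
  exchange-forest {X} {Y} {e} {f} forest cut Y⊆ {g} y w with Y⊆ y
  ... | inj₂ refl = cut (mapWalk (drop-added Y⊆) w)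
  ... | inj₁ (x , g≢e)
    with reroute {Z′ = X − e} f (drop-added Y⊆ ∘ Product.map₁ proj₁) (x , g≢e) w
  ...   | inj₁ w′ =
    forest x (mapWalk (λ ((y′ , ≢g) , ≢f) → proj₁ (drop-added Y⊆ (y′ , ≢f)) , ≢g) w′)
  ...   | inj₂ w′ = cut w′

  cycleEdge-separates : ∀ {B e f} → Forest B → e ≢ f → Cyc G B e f →
    ¬ Walk G (B − f) (end₁ e) (end₂ e)
  cycleEdge-separates forest e≢f (inj₁ f≡e) = ⊥-elim (e≢f (sym f≡e))
  cycleEdge-separates forest e≢f (inj₂ ((w , uniq) , f∈)) = pathEdge-separates forest w uniq f∈

  uniqueExchange-forests : ∀ {A B A′ B′ e f} → Forest A → Forest B → e ≢ f →
    UniqueXExchange G A B (e , f) → A′ ⊆ (A − e) ∪ ｛ f ｝ → B′ ⊆ (B − f) ∪ ｛ e ｝ →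
    Forest A′ × Forest B′
  uniqueExchange-forests {f = f} forestA forestB e≢f (_ , _ , unique) A′⊆ B′⊆ =
    exchange-forest forestA (proj₁ f∈D∩C) A′⊆ ,
    exchange-forest forestB (cycleEdge-separates forestB e≢f (proj₂ f∈D∩C)) B′⊆
    where f∈D∩C = proj₂ (unique f) (inj₂ refl)

  uniqueExchange-reverse : ∀ {A B A′ B′ e f} → Forest B → e ≢ f →
    A′ ≐ (A − e) ∪ ｛ f ｝ → B′ ≐ (B − f) ∪ ｛ e ｝ →
    UniqueXExchange G A B (e , f) → UniqueXExchange G A′ B′ (f , e)
  uniqueExchange-reverse {A} {B} {A′} {B′} {e} {f}
                         forestB e≢f (A′⊆ , A′⊇) (B′⊆ , B′⊇) (_ , bf , unique) =
    A′⊇ (inj₂ refl) , B′⊇ (inj₂ refl) , λ g → toOld g , fromOld g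
    where
      cutf : Cut G A e f
      cutf = proj₁ (proj₂ (unique f) (inj₂ refl))

      cycf : Cyc G B e f
      cycf = proj₂ (proj₂ (unique f) (inj₂ refl))

      ¬Af : ¬ A f
      ¬Af af = cutf (edgeWalk (af , e≢f ∘ sym))

      cutToNew : ∀ {g} → Cut G A e g → Cut G A′ f g
      cutToNew cut = cut ∘ mapWalk (drop-added A′⊆)

      cutToOld : ∀ {g} → Cut G A′ f g → Cut G A e g
      cutToOld cut = cut ∘ mapWalk (λ (a , g≢e) → A′⊇ (inj₁ (a , g≢e)) , λ { refl → ¬Af a })

      separates : ¬ Walk G (B − f) (end₁ e) (end₂ e)
      separates = cycleEdge-separates forestB e≢f cycf

      cyclePath : Cyc G B e f → Path G B (end₁ e) (end₂ e)
      cyclePath (inj₁ f≡e) = ⊥-elim (e≢f (sym f≡e))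
      cyclePath (inj₂ (p , _)) = p

      forestB′ : Forest B′
      forestB′ = exchange-forest forestB separates B′⊆

      toOld : ∀ g → Cut G A′ f g × Cyc G B′ f g → g ≡ f ⊎ g ≡ e
      toOld g (_ , inj₁ g≡f) = inj₁ g≡f
      toOld g (cut , inj₂ ((q , uniq) , g∈q)) with g ≟ e
      ... | yes g≡e = inj₂ g≡e
      ... | no g≢e =
        Sum.swap (proj₁ (unique g) (cutToOld cut , inj₂ (P , separating-edge∈ (proj₁ P) cutg)))
        where
          P = cyclePath cycf
          cutg : ¬ Walk G (B − g) (end₁ e) (end₂ e)
          cutg w with reroute f (λ ((b , ≢g) , ≢f) → B′⊇ (inj₁ (b , ≢f)) , ≢g)
                                (B′⊇ (inj₂ refl) , g≢e ∘ sym) w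
          ... | inj₁ w′ = separates (mapWalk (Product.map₁ proj₁) w′)
          ... | inj₂ w′ = pathEdge-separates forestB′ q uniq g∈q w′

      fromOld : ∀ g → g ≡ f ⊎ g ≡ e → Cut G A′ f g × Cyc G B′ f g
      fromOld g (inj₁ refl) = cutToNew cutf , inj₁ refl
      fromOld g (inj₂ refl) =
        cutToNew (proj₁ (proj₂ (unique e) (inj₁ refl))) ,
        inj₂ (Q , separating-edge∈ (proj₁ Q) cute)
        where
          Q : Path G B′ (end₁ f) (end₂ f)
          Q with reroute f (B′⊇ ∘ inj₁) (B′⊇ (inj₂ refl)) (proj₁ (cyclePath cycf))
          ... | inj₁ w = ⊥-elim (separates w)
          ... | inj₂ w = walk⇒path w
          cute : ¬ Walk G (B′ − e) (end₁ f) (end₂ f)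
          cute = forestB bf ∘ mapWalk (drop-added B′⊆)

  -- UniqueYExchange G X Y is definitionally UniqueXExchange G Y X.
  ExchangeStep : EdgeSet k → EdgeSet k → Fin k → Fin k → Fin k × Fin k → Set
  ExchangeStep X Y a b q =
    ((q ≡ (a , b)) ⊎ (q ≡ (b , a))) × (UniqueXExchange G X Y q ⊎ UniqueYExchange G X Y q)

  exchangeStep-cases : ∀ {X Y a b q} → ¬ X b → ¬ Y a → ExchangeStep X Y a b q →
    (q ≡ (a , b) × UniqueXExchange G X Y (a , b)) ⊎
    (q ≡ (b , a) × UniqueXExchange G Y X (b , a))
  exchangeStep-cases ¬Xb ¬Ya (inj₁ refl , inj₁ u) = inj₁ (refl , u)
  exchangeStep-cases ¬Xb ¬Ya (inj₁ refl , inj₂ u) = ⊥-elim (¬Ya (proj₁ u))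
  exchangeStep-cases ¬Xb ¬Ya (inj₂ refl , inj₁ u) = ⊥-elim (¬Xb (proj₁ u))
  exchangeStep-cases ¬Xb ¬Ya (inj₂ refl , inj₂ u) = inj₂ (refl , u)

  exchangeStep-forests : ∀ {X Y X′ Y′ a b q} →
    Forest X → Forest Y → a ≢ b → ¬ X b → ¬ Y a →
    X′ ⊆ (X − a) ∪ ｛ b ｝ → Y′ ⊆ (Y − b) ∪ ｛ a ｝ → ExchangeStep X Y a b q →
    Forest X′ × Forest Y′
  exchangeStep-forests forestX forestY a≢b ¬Xb ¬Ya X′⊆ Y′⊆ step
    with exchangeStep-cases ¬Xb ¬Ya step
  ... | inj₁ (_ , u) = uniqueExchange-forests forestX forestY a≢b u X′⊆ Y′⊆
  ... | inj₂ (_ , u) =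
    Product.swap (uniqueExchange-forests forestY forestX (a≢b ∘ sym) u Y′⊆ X′⊆)

  exchangeStep-reverse : ∀ {X Y X′ Y′ a b q} →
    Forest X → Forest Y → a ≢ b → ¬ X b → ¬ Y a →
    X′ ≐ (Y − b) ∪ ｛ a ｝ → Y′ ≐ (X − a) ∪ ｛ b ｝ → ExchangeStep X Y a b q →
    ExchangeStep X′ Y′ a b (swap q)
  exchangeStep-reverse forestX forestY a≢b ¬Xb ¬Ya X′≐ Y′≐ step
    with exchangeStep-cases ¬Xb ¬Ya step
  ... | inj₁ (refl , u) = inj₂ refl , inj₂ (uniqueExchange-reverse forestY a≢b Y′≐ X′≐ u)
  ... | inj₂ (refl , u) =
    inj₁ refl , inj₁ (uniqueExchange-reverse forestX (a≢b ∘ sym) X′≐ Y′≐ u)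

  window-suc : ∀ {m} {s t : Fin m → Fin k} → Injective _≡_ _≡_ s → (∀ i j → s i ≢ t j) →
    ∀ i → Window s t (suc (toℕ i)) ≐ (Window s t (toℕ i) − s i) ∪ ｛ t i ｝
  window-suc {s = s} {t} injective disjoint i = into , onto
    where
      into : Window s t (suc (toℕ i)) ⊆ (Window s t (toℕ i) − s i) ∪ ｛ t i ｝
      into (inj₁ (j , i<j , refl)) =
        inj₁ ( inj₁ (j , <⇒≤ i<j , refl)
             , λ sj≡si → <-irrefl (cong toℕ (sym (injective sj≡si))) i<j)
      into (inj₂ (j , j≤i , refl)) with m<1+n⇒m<n∨m≡n j≤i
      ... | inj₁ j<i = inj₁ (inj₂ (j , j<i , refl) , λ tj≡si → disjoint i j (sym tj≡si))
      ... | inj₂ j≡i = inj₂ (cong t (sym (toℕ-injective j≡i)))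

      onto : (Window s t (toℕ i) − s i) ∪ ｛ t i ｝ ⊆ Window s t (suc (toℕ i))
      onto (inj₂ refl) = inj₂ (i , ≤-refl , refl)
      onto (inj₁ (inj₂ (j , j<i , refl) , _)) = inj₂ (j , m<n⇒m<1+n j<i , refl)
      onto (inj₁ (inj₁ (j , i≤j , refl) , sj≢si)) =
        inj₁ (j , ≤∧≢⇒< i≤j (λ i≡j → sj≢si (cong s (sym (toℕ-injective i≡j)))) , refl)

  window-zero⊆ : ∀ {m} {s t : Fin m → Fin k} {S} → Enumerates G s S → Window s t 0 ⊆ S
  window-zero⊆ (_ , covers) (inj₁ (j , _ , refl)) = proj₂ (covers _) (j , refl)

  enumerates-opposite : ∀ {m} {u : Fin m → Fin k} {U} →
    Enumerates G u U → Enumerates G (u ∘ opposite) U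
  enumerates-opposite {u = u} (injective , covers) =
    opposite-injective ∘ injective ,
    λ g → (λ ug → let (i , ui≡g) = proj₁ (covers g) ug in
                   opposite i , trans (cong u (opposite-involutive i)) ui≡g) ,
          (λ (i , ui≡g) → proj₂ (covers g) (opposite i , ui≡g))

  module _ {m : ℕ} {S T : EdgeSet k}
    (forestS : Forest S) (forestT : Forest T) (disjoint : ∀ g → S g → T g → ⊥)
    {s t : Fin m → Fin k} (enumS : Enumerates G s S) (enumT : Enumerates G t T)
    {σ : Fin m → Fin k × Fin k}
    (steps : ∀ i → ExchangeStep (Xᵢ G s t i) (Yᵢ G s t i) (s i) (t i) (σ i)) where

    s≢t : ∀ i j → s i ≢ t j
    s≢t i j si≡tj = disjoint (t j) (subst S si≡tj (proj₂ (proj₂ enumS _) (i , refl)))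
                                  (proj₂ (proj₂ enumT _) (j , refl))

    t≢s : ∀ i j → t i ≢ s j
    t≢s i j = s≢t j i ∘ sym

    t∉X : ∀ i → ¬ Window s t (toℕ i) (t i)
    t∉X = window-notin (proj₁ enumT) s≢t

    s∉Y : ∀ i → ¬ Window t s (toℕ i) (s i)
    s∉Y = window-notin (proj₁ enumS) t≢s

    X-suc : ∀ i → Window s t (suc (toℕ i)) ≐ (Window s t (toℕ i) − s i) ∪ ｛ t i ｝
    X-suc = window-suc (proj₁ enumS) s≢t

    Y-suc : ∀ i → Window t s (suc (toℕ i)) ≐ (Window t s (toℕ i) − t i) ∪ ｛ s i ｝
    Y-suc = window-suc (proj₁ enumT) t≢s

    WindowForests : ℕ → Set
    WindowForests i = Forest (Window s t i) × Forest (Window t s i)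

    windowForests-suc : ∀ i → WindowForests (toℕ i) → WindowForests (suc (toℕ i))
    windowForests-suc i (forestX , forestY) =
      exchangeStep-forests forestX forestY (s≢t i i) (t∉X i) (s∉Y i)
        (proj₁ (X-suc i)) (proj₁ (Y-suc i)) (steps i)

    windowForests : ∀ i → i ℕ.≤ m → WindowForests i
    windowForests zero _ =
      forest-⊆ forestS (window-zero⊆ enumS) , forest-⊆ forestT (window-zero⊆ enumT)
    windowForests (suc i) i<m =
      subst (WindowForests ∘ suc) (toℕ-fromℕ< i<m)
        (windowForests-suc (fromℕ< i<m)
          (subst WindowForests (sym (toℕ-fromℕ< i<m)) (windowForests i (<⇒≤ i<m))))

    reversedSteps : ∀ i →
      ExchangeStep (Xᵢ G (s ∘ opposite) (t ∘ opposite) i)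
                   (Yᵢ G (s ∘ opposite) (t ∘ opposite) i)
        (s (opposite i)) (t (opposite i)) (swap (σ (opposite i)))
    reversedSteps i =
      exchangeStep-reverse forestX forestY (s≢t j j) (t∉X j) (s∉Y j)
        (≐-trans (window-opposite s t i) (Y-suc j))
        (≐-trans (window-opposite t s i) (X-suc j))
        (steps j)
      where
        j = opposite i
        forestX = proj₁ (windowForests (toℕ j) (<⇒≤ (toℕ<n j)))
        forestY = proj₂ (windowForests (toℕ j) (<⇒≤ (toℕ<n j)))

mainTheorem6 : ∀ {n k : ℕ} (G : Graph n k) → Bispanning G →
    (S T : EdgeSet k) → SpanningTree G S → SpanningTree G T → Partition G S T →
    (m : ℕ) → m + m ≡ k →
    (σ : Fin m → Fin k × Fin k) →
    UECBO G S T m σ → UECBO G S T m (reverseSeq σ)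
mainTheorem6 G _ S T (_ , acyclicS) (_ , acyclicT) (disjoint , _) m _ σ
             (s , t , enumS , enumT , steps) =
  s ∘ opposite , t ∘ opposite , enumerates-opposite G enumS , enumerates-opposite G enumT ,
  reversedSteps G (acyclic⇒forest G acyclicS) (acyclic⇒forest G acyclicT) disjoint
    enumS enumT steps
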